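{- Let $n\ge4$ and $\lambda=(n-2,2)$. Then $P(\lambda)\smallsetminus\{0\}$, with elements identified with $\{1,2,\dots,n-2\}$, is the following poset: its minimal elements are $1,2,\dots,\lfloor\frac{n-1}{2}\rfloor$, its maximal elements are $\lfloor\frac{n-1}{2}\rfloor+1,\dots,n-2$, and the cover relations are exactly that, for each $j\ge1$ with $\lfloor\frac{n-1}{2}\rfloor+j\le n-2$, the maximal element $\lfloor\frac{n-1}{2}\rfloor+j$ covers each of $j,j+1,\dots,\lfloor\frac{n-1}{2}\rfloor$.
   Context: For $\lambda=(\lambda_1,\dots,\lambda_d)$ positive integers summing to $n$, $\Delta_\lambda=\mathrm{conv}(e_1,\dots,e_d,\lambda)\subset\mathbb{R}^d$ ($e_i$ standard basis vectors), with fundamental parallelepiped $\Pi_\lambda=\{\sum_{i=1}^d\gamma_i(1,e_i)+\gamma_{d+1}(1,\lambda): 0\le\gamma_i<1\}$. The poset $P(\lambda)$ is $\Pi_\lambda\cap\mathbb{Z}^{d+1}$ with $\sigma\preceq\mu$ iff $\mu-\sigma\in\Pi_\lambda\cap\mathbb{Z}^{d+1}$. Its elements are identified with $b\in\{0,\dots,n-2\}$ via the bijection $b\mapsto p(b)=\big((\sum_{t}\lceil b\lambda_t/(n-1)\rceil)-b,\lceil b\lambda_1/(n-1)\rceil,\dots,\lceil b\lambda_d/(n-1)\rceil\big)$; $b=0$ corresponds to the origin. -}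

module Defs where

open import Data.Nat using (ℕ; zero; suc; _+_; _*_; _∸_; _/_; _≤_; _<_)
open import Data.Vec using (Vec; []; _∷_; map; sum; zipWith)
open import Data.Product using (Σ; _×_; _,_)
open import Relation.Binary.PropositionalEquality using (_≡_)
open import Relation.Nullary using (¬_)

-- ceiling division ⌈ a / m ⌉ for m ≥ 1 (value at m = 0 is irrelevant, set to 0)
ceilDiv : ℕ → ℕ → ℕ
ceilDiv a zero    = 0
ceilDiv a (suc m) = (a + m) / suc m

-- lattice points of ℤ^{d+1}, all of whose coordinates are ≥ 0 here
Pt : ℕ → Set
Pt d = ℕ × Vec ℕ d

addPt : ∀ {d} → Pt d → Pt d → Pt d
addPt (x , xs) (y , ys) = (x + y , zipWith _+_ xs ys)

total : ∀ {d} → Vec ℕ d → ℕ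
total = sum

-- the bijection b ↦ p(b) onto Π_λ ∩ ℤ^{d+1}
-- p(b) = ((Σ_t ⌈bλ_t/(n-1)⌉) - b, ⌈bλ_1/(n-1)⌉, …, ⌈bλ_d/(n-1)⌉)
pt : ∀ {d} → Vec ℕ d → ℕ → Pt d
pt lam b = (sum cs ∸ b , cs)
  where cs = map (λ t → ceilDiv (b * t) (total lam ∸ 1)) lam

IsElem : ∀ {d} → Vec ℕ d → ℕ → Set
IsElem lam b = b < total lam ∸ 1

-- σ ⪯ μ iff μ - σ ∈ Π_λ ∩ ℤ^{d+1}, i.e. μ = σ + p(c) for some element c
_⊢_≼_ : ∀ {d} → Vec ℕ d → ℕ → ℕ → Set
lam ⊢ a ≼ b = Σ ℕ λ c → IsElem lam c × (pt lam b ≡ addPt (pt lam a) (pt lam c))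

_⊢_≺_ : ∀ {d} → Vec ℕ d → ℕ → ℕ → Set
lam ⊢ a ≺ b = (lam ⊢ a ≼ b) × ¬ (a ≡ b)

IsElem⁺ : ∀ {d} → Vec ℕ d → ℕ → Set
IsElem⁺ lam b = (1 ≤ b) × IsElem lam b

IsMinimal⁺ : ∀ {d} → Vec ℕ d → ℕ → Set
IsMinimal⁺ lam b = IsElem⁺ lam b × (∀ a → IsElem⁺ lam a → lam ⊢ a ≼ b → a ≡ b)

IsMaximal⁺ : ∀ {d} → Vec ℕ d → ℕ → Set
IsMaximal⁺ lam b = IsElem⁺ lam b × (∀ a → IsElem⁺ lam a → lam ⊢ b ≼ a → a ≡ b)

Covers⁺ : ∀ {d} → Vec ℕ d → ℕ → ℕ → Set
Covers⁺ lam b a = IsElem⁺ lam a × IsElem⁺ lam b × (lam ⊢ a ≺ b)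
  × (∀ c → IsElem⁺ lam c → ¬ ((lam ⊢ a ≺ c) × (lam ⊢ c ≺ b)))

module Submission where

-- For 0 ≤ b ≤ n - 2 one has ⌈b(n - 2)/(n - 1)⌉ = b, so p(b) = (ℓ b, b, ℓ b) with
-- ℓ b = ⌈2b/(n - 1)⌉, which is 1 for 1 ≤ b ≤ H = ⌊(n - 1)/2⌋ and 2 for H < b ≤ n - 2.
-- Thus a ⪯ b with a ≠ b means b = a + c with c ≥ 1 and ℓ b = ℓ a + ℓ c, and since
-- every level is 1 or 2 this forces a ≤ H, c ≤ H and H < b.  So the nonzero part of
-- P(λ) is the height-one poset in which a < b iff a ≤ H < b ≤ a + H, and its minimal
-- and maximal elements and its cover relations can be read off directly.

open import Defs
open import Data.Nat using (ℕ; zero; suc; _+_; _*_; _∸_; _/_; _≤_; _<_; z≤n; s≤s; s≤s⁻¹; _≤?_; NonZero)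
open import Data.Nat.Properties
open import Data.Nat.DivMod using (m≡m%n+[m/n]*n; m%n<n; m*n/n≡m; /-monoˡ-≤; m<n*o⇒m/o<n; m/n*n≤m; m≥n⇒m/n>0)
open import Data.Vec using (Vec; []; _∷_)
open import Data.Vec.Properties using (∷-injective; ∷-injectiveˡ)
open import Data.Product.Properties using (,-injective)
open import Data.Product using (Σ; _×_; _,_; proj₁; proj₂; map₂)
open import Data.Empty using (⊥-elim)
open import Data.Sum using (_⊎_; inj₁; inj₂)
open import Function.Bundles using (_⇔_; mk⇔; Equivalence)
open import Function using (case_of_)
open import Function.Construct.Composition using (_⇔-∘_)
open import Relation.Nullary using (¬_; yes; no)
open import Relation.Binary.PropositionalEquality
  using (_≡_; refl; sym; trans; cong; cong₂; subst; module ≡-Reasoning)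

q*n≤m<[1+q]*n⇒m/n≡q : ∀ {m n} q .{{_ : NonZero n}} →
                       q * n ≤ m → m < suc q * n → m / n ≡ q
q*n≤m<[1+q]*n⇒m/n≡q {m} {n} q lo hi = ≤-antisym
  (s≤s⁻¹ (m<n*o⇒m/o<n hi))
  (subst (_≤ m / n) (m*n/n≡m q n) (/-monoˡ-≤ n lo))

ceilDiv-≡suc : ∀ {a} d q → q * suc d < a → a ≤ suc q * suc d → ceilDiv a (suc d) ≡ suc q
ceilDiv-≡suc {a} d q lo hi = q*n≤m<[1+q]*n⇒m/n≡q (suc q)
  (subst (_≤ a + d) (cong suc (+-comm (q * suc d) d)) (+-monoˡ-≤ d lo))
  (subst (a + d <_) (+-comm (suc q * suc d) (suc d)) (+-mono-≤-< hi (n<1+n d)))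

⌈m*n/1+n⌉≡m : ∀ {m n} → m ≤ n → ceilDiv (m * n) (suc n) ≡ m
⌈m*n/1+n⌉≡m {m} {n} m≤n = q*n≤m<[1+q]*n⇒m/n≡q m lo hi
  where
  lo : m * suc n ≤ m * n + n
  lo = subst (_≤ m * n + n) (sym (trans (*-suc m n) (+-comm m (m * n)))) (+-monoʳ-≤ (m * n) m≤n)
  hi : m * n + n < suc m * suc n
  hi = s≤s (subst (m * n + n ≤_) (+-comm (m * suc n) n) (+-monoˡ-≤ n (*-monoʳ-≤ m (n≤1+n n))))

⌈2m/n⌉≡1 : ∀ {m} d → 1 ≤ m → m ≤ suc d / 2 → ceilDiv (m * 2) (suc d) ≡ 1
⌈2m/n⌉≡1 {m} d 1≤m m≤n/2 = ceilDiv-≡suc d 0 (≤-trans (n≤1+n 1) (*-monoˡ-≤ 2 1≤m))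
  (subst (m * 2 ≤_) (sym (+-identityʳ (suc d))) (≤-trans (*-monoˡ-≤ 2 m≤n/2) (m/n*n≤m (suc d) 2)))

⌈2m/n⌉≡2 : ∀ {m} d → suc d / 2 < m → m ≤ suc d → ceilDiv (m * 2) (suc d) ≡ 2
⌈2m/n⌉≡2 {m} d n/2<m m≤n = ceilDiv-≡suc d 1 lo hi
  where
  lo : 1 * suc d < m * 2
  lo with m * 2 ≤? suc d
  ... | no 2m≰n = subst (_< m * 2) (sym (+-identityʳ (suc d))) (≰⇒> 2m≰n)
  ... | yes 2m≤n = ⊥-elim (<⇒≱ n/2<m (subst (_≤ suc d / 2) (m*n/n≡m m 2) (/-monoˡ-≤ 2 2m≤n)))
  hi : m * 2 ≤ 2 * suc d
  hi = subst (m * 2 ≤_) (*-comm (suc d) 2) (*-monoˡ-≤ 2 m≤n)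

n≤1+[n/2]*2 : ∀ n → n ≤ suc (n / 2 * 2)
n≤1+[n/2]*2 n = subst (_≤ suc (n / 2 * 2)) (sym (m≡m%n+[m/n]*n n 2)) (+-monoˡ-≤ (n / 2 * 2) (s≤s⁻¹ (m%n<n n 2)))

-- n = m + 4, so that λ = (n - 2, 2) = (K, 2), N = n - 1 and H = ⌊(n - 1)/2⌋.
module Δ[K,2] (m : ℕ) where

  K N H : ℕ
  K = suc (suc m)
  N = suc K
  H = N / 2

  lam : Vec ℕ 2
  lam = K ∷ 2 ∷ []

  level : ℕ → ℕ
  level x = ceilDiv (x * 2) N

  level-low : ∀ {x} → 1 ≤ x → x ≤ H → level x ≡ 1
  level-low = ⌈2m/n⌉≡1 K

  level-high : ∀ {x} → H < x → x ≤ K → level x ≡ 2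
  level-high H<x x≤K = ⌈2m/n⌉≡2 K H<x (≤-trans x≤K (n≤1+n K))

  level-cases : ∀ {x} → 1 ≤ x → x ≤ K → (x ≤ H × level x ≡ 1) ⊎ (H < x × level x ≡ 2)
  level-cases {x} 1≤x x≤K with x ≤? H
  ... | yes x≤H = inj₁ (x≤H , level-low 1≤x x≤H)
  ... | no x≰H  = inj₂ (≰⇒> x≰H , level-high (≰⇒> x≰H) x≤K)

  pt-normal : ∀ {x} → x ≤ K → pt lam x ≡ (level x , x ∷ level x ∷ [])
  pt-normal {x} x≤K = begin
      pt lam x
    ≡⟨ cong ptWith (cong suc (+-comm m 2)) ⟩
      ptWith N
    ≡⟨ cong (λ y → (y + (level x + 0) ∸ x , y ∷ level x ∷ [])) (⌈m*n/1+n⌉≡m x≤K) ⟩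
      (x + (level x + 0) ∸ x , x ∷ level x ∷ [])
    ≡⟨ cong (λ y → (y , x ∷ level x ∷ [])) (trans (m+n∸m≡n x (level x + 0)) (+-identityʳ (level x))) ⟩
      (level x , x ∷ level x ∷ [])
    ∎
    where
    open ≡-Reasoning
    -- the denominator of pt lam x reduces to suc (m + 2), not to N
    ptWith : ℕ → Pt 2
    ptWith D = (ceilDiv (x * K) D + (ceilDiv (x * 2) D + 0) ∸ x , ceilDiv (x * K) D ∷ ceilDiv (x * 2) D ∷ [])

  1≤H : 1 ≤ H
  1≤H = m≥n⇒m/n>0 {N} {2} (s≤s (s≤s z≤n))

  H<K : H < K
  H<K = *-cancelʳ-< 2 H K (≤-<-trans (m/n*n≤m N 2) (s≤s (s≤s (s≤s (s≤s (m≤m*n m 2))))))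

  H≤K : H ≤ K
  H≤K = <⇒≤ H<K

  K≤H+H : K ≤ H + H
  K≤H+H = subst (K ≤_) (trans (*-comm H 2) (cong (H +_) (+-identityʳ H))) (s≤s⁻¹ (n≤1+[n/2]*2 N))

  Elem : ℕ → Set
  Elem x = 1 ≤ x × x ≤ K

  IsElem⇔ : ∀ {x} → IsElem lam x ⇔ x ≤ K
  IsElem⇔ {x} = mk⇔
    (λ x<n-1 → subst (x ≤_) (+-comm m 2) (s≤s⁻¹ x<n-1))
    (λ x≤K → s≤s (subst (x ≤_) (+-comm 2 m) x≤K))

  IsElem⁺⇔ : ∀ {x} → IsElem⁺ lam x ⇔ Elem x
  IsElem⁺⇔ = mk⇔ (map₂ (Equivalence.to IsElem⇔)) (map₂ (Equivalence.from IsElem⇔))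

  pt-additive⇔ : ∀ {a b c} → a ≤ K → b ≤ K → c ≤ K →
                 pt lam b ≡ addPt (pt lam a) (pt lam c) ⇔ (b ≡ a + c × level b ≡ level a + level c)
  pt-additive⇔ {a} {b} {c} a≤K b≤K c≤K = mk⇔
    (λ e → let (_ , coords) = ,-injective (trans (sym (pt-normal b≤K)) (trans e normal-sum))
               (b≡a+c , levels) = ∷-injective coords
           in b≡a+c , ∷-injectiveˡ levels)
    (λ (b≡a+c , lb≡la+lc) → trans (pt-normal b≤K)
      (trans (cong₂ (λ x y → (y , x ∷ y ∷ [])) b≡a+c lb≡la+lc) (sym normal-sum)))
    where
    normal-sum : addPt (pt lam a) (pt lam c) ≡ (level a + level c , a + c ∷ level a + level c ∷ [])
    normal-sum = cong₂ addPt (pt-normal a≤K) (pt-normal c≤K)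

  _⊏_ : ℕ → ℕ → Set
  a ⊏ b = a ≤ H × H < b × b ≤ a + H

  level-sum⇒low+low≡high : ∀ {a b c} → Elem a → Elem b → Elem c →
                level b ≡ level a + level c → a ≤ H × c ≤ H × H < b
  level-sum⇒low+low≡high {a} {b} {c} (1≤a , a≤K) (1≤b , b≤K) (1≤c , c≤K) lb≡la+lc =
    shape (level-cases 1≤a a≤K) (level-cases 1≤b b≤K) (level-cases 1≤c c≤K)
    where
    values : ∀ {u v w} → level a ≡ u → level b ≡ w → level c ≡ v → w ≡ u + v
    values la lb lc = trans (sym lb) (trans lb≡la+lc (cong₂ _+_ la lc))
    shape : (a ≤ H × level a ≡ 1) ⊎ (H < a × level a ≡ 2) →
            (b ≤ H × level b ≡ 1) ⊎ (H < b × level b ≡ 2) →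
            (c ≤ H × level c ≡ 1) ⊎ (H < c × level c ≡ 2) → a ≤ H × c ≤ H × H < b
    shape (inj₁ (a≤H , _))  (inj₂ (H<b , _))  (inj₁ (c≤H , _))  = a≤H , c≤H , H<b
    shape (inj₁ (_ , la)) (inj₁ (_ , lb)) (inj₁ (_ , lc)) = case values la lb lc of λ ()
    shape (inj₁ (_ , la)) (inj₁ (_ , lb)) (inj₂ (_ , lc)) = case values la lb lc of λ ()
    shape (inj₁ (_ , la)) (inj₂ (_ , lb)) (inj₂ (_ , lc)) = case values la lb lc of λ ()
    shape (inj₂ (_ , la)) (inj₁ (_ , lb)) (inj₁ (_ , lc)) = case values la lb lc of λ ()
    shape (inj₂ (_ , la)) (inj₁ (_ , lb)) (inj₂ (_ , lc)) = case values la lb lc of λ ()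
    shape (inj₂ (_ , la)) (inj₂ (_ , lb)) (inj₁ (_ , lc)) = case values la lb lc of λ ()
    shape (inj₂ (_ , la)) (inj₂ (_ , lb)) (inj₂ (_ , lc)) = case values la lb lc of λ ()

  ≼⇒≡⊎⊏ : ∀ {a b} → Elem a → Elem b → lam ⊢ a ≼ b → a ≡ b ⊎ a ⊏ b
  ≼⇒≡⊎⊏ a∈ b∈ (c , c∈ , e)
    with Equivalence.to (pt-additive⇔ (proj₂ a∈) (proj₂ b∈) (Equivalence.to IsElem⇔ c∈)) e
  ≼⇒≡⊎⊏ {a} a∈ b∈ (zero , _ , _) | refl , _ = inj₁ (sym (+-identityʳ a))
  ≼⇒≡⊎⊏ {a} a∈ b∈ (suc c , c∈ , _) | refl , levels
    with level-sum⇒low+low≡high a∈ b∈ (s≤s z≤n , Equivalence.to IsElem⇔ c∈) levels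
  ... | a≤H , c≤H , H<b = inj₂ (a≤H , H<b , +-monoʳ-≤ a c≤H)

  ⊏⇒≼ : ∀ {a b} → 1 ≤ a → b ≤ K → a ⊏ b → lam ⊢ a ≼ b
  ⊏⇒≼ {a} {b} 1≤a b≤K (a≤H , H<b , b≤a+H) =
    c , Equivalence.from IsElem⇔ c≤K ,
    Equivalence.from (pt-additive⇔ (≤-trans a≤H H≤K) b≤K c≤K)
      (sym (m+[n∸m]≡n a≤b) , trans (level-high H<b b≤K) (sym (cong₂ _+_ (level-low 1≤a a≤H) (level-low 1≤c c≤H))))
    where
    c = b ∸ a
    a<b = ≤-<-trans a≤H H<b
    a≤b = <⇒≤ a<b
    1≤c : 1 ≤ c
    1≤c = m<n⇒0<n∸m a<b
    c≤H : c ≤ H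
    c≤H = m≤n+o⇒m∸n≤o b a b≤a+H
    c≤K : c ≤ K
    c≤K = ≤-trans c≤H H≤K

  ≺⇒⊏ : ∀ {a b} → Elem a → Elem b → lam ⊢ a ≺ b → a ⊏ b
  ≺⇒⊏ a∈ b∈ (a≼b , a≢b) with ≼⇒≡⊎⊏ a∈ b∈ a≼b
  ... | inj₁ a≡b = ⊥-elim (a≢b a≡b)
  ... | inj₂ a⊏b = a⊏b

  minimal⇔ : ∀ b → IsMinimal⁺ lam b ⇔ (1 ≤ b × b ≤ H)
  minimal⇔ b = mk⇔ to from
    where
    to : IsMinimal⁺ lam b → 1 ≤ b × b ≤ H
    to (b∈⁺ , minimal) with Equivalence.to IsElem⁺⇔ b∈⁺ | b ≤? H
    ... | 1≤b , _   | yes b≤H = 1≤b , b≤H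
    ... | _   , b≤K | no b≰H  = ⊥-elim (<⇒≢ (≰⇒> b≰H) (minimal H H∈⁺ (⊏⇒≼ 1≤H b≤K H⊏b)))
      where
      H∈⁺ = Equivalence.from IsElem⁺⇔ (1≤H , H≤K)
      H⊏b = ≤-refl , ≰⇒> b≰H , ≤-trans b≤K K≤H+H
    from : 1 ≤ b × b ≤ H → IsMinimal⁺ lam b
    from (1≤b , b≤H) = Equivalence.from IsElem⁺⇔ b∈ , below
      where
      b∈ = 1≤b , ≤-trans b≤H H≤K
      below : ∀ a → IsElem⁺ lam a → lam ⊢ a ≼ b → a ≡ b
      below a a∈⁺ a≼b with ≼⇒≡⊎⊏ (Equivalence.to IsElem⁺⇔ a∈⁺) b∈ a≼b
      ... | inj₁ a≡b = a≡b
      ... | inj₂ (_ , H<b , _) = ⊥-elim (<⇒≱ H<b b≤H)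

  maximal⇔ : ∀ b → IsMaximal⁺ lam b ⇔ (suc H ≤ b × b ≤ K)
  maximal⇔ b = mk⇔ to from
    where
    to : IsMaximal⁺ lam b → suc H ≤ b × b ≤ K
    to (b∈⁺ , maximal) with Equivalence.to IsElem⁺⇔ b∈⁺ | b ≤? H
    ... | _   , b≤K | no b≰H  = ≰⇒> b≰H , b≤K
    ... | 1≤b , _   | yes b≤H = ⊥-elim (<⇒≢ (s≤s b≤H) (sym (maximal (suc H) H+1∈⁺ (⊏⇒≼ 1≤b H<K b⊏H+1))))
      where
      H+1∈⁺ = Equivalence.from IsElem⁺⇔ (s≤s z≤n , H<K)
      b⊏H+1 = b≤H , ≤-refl , +-monoˡ-≤ H 1≤b
    from : suc H ≤ b × b ≤ K → IsMaximal⁺ lam b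
    from (H<b , b≤K) = Equivalence.from IsElem⁺⇔ b∈ , above
      where
      b∈ = ≤-trans (s≤s z≤n) H<b , b≤K
      above : ∀ a → IsElem⁺ lam a → lam ⊢ b ≼ a → a ≡ b
      above a a∈⁺ b≼a with ≼⇒≡⊎⊏ b∈ (Equivalence.to IsElem⁺⇔ a∈⁺) b≼a
      ... | inj₁ b≡a = sym b≡a
      ... | inj₂ (b≤H , _) = ⊥-elim (<⇒≱ H<b b≤H)

  covers⇔⊏ : ∀ a b → Covers⁺ lam b a ⇔ (1 ≤ a × a ⊏ b × b ≤ K)
  covers⇔⊏ a b = mk⇔ to from
    where
    to : Covers⁺ lam b a → 1 ≤ a × a ⊏ b × b ≤ K
    to (a∈⁺ , b∈⁺ , a≺b , _) = proj₁ a∈ , ≺⇒⊏ a∈ b∈ a≺b , proj₂ b∈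
      where
      a∈ = Equivalence.to IsElem⁺⇔ a∈⁺
      b∈ = Equivalence.to IsElem⁺⇔ b∈⁺
    from : 1 ≤ a × a ⊏ b × b ≤ K → Covers⁺ lam b a
    from (1≤a , a⊏b@(a≤H , H<b , _) , b≤K) =
      Equivalence.from IsElem⁺⇔ a∈ , Equivalence.from IsElem⁺⇔ b∈ ,
      (⊏⇒≼ 1≤a b≤K a⊏b , <⇒≢ (≤-<-trans a≤H H<b)) , no-middle
      where
      a∈ = 1≤a , ≤-trans a≤H H≤K
      b∈ = ≤-trans (s≤s z≤n) H<b , b≤K
      no-middle : ∀ c → IsElem⁺ lam c → ¬ ((lam ⊢ a ≺ c) × (lam ⊢ c ≺ b))
      no-middle c c∈⁺ (a≺c , c≺b) = <⇒≱ H<c c≤H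
        where
        c∈ = Equivalence.to IsElem⁺⇔ c∈⁺
        H<c = proj₁ (proj₂ (≺⇒⊏ a∈ c∈ a≺c))
        c≤H = proj₁ (≺⇒⊏ c∈ b∈ c≺b)

  ⊏⇔jump : ∀ {a b} → (1 ≤ a × a ⊏ b × b ≤ K) ⇔
           Σ ℕ (λ j → (1 ≤ j) × (b ≡ H + j) × (b ≤ K) × (j ≤ a) × (a ≤ H))
  ⊏⇔jump {a} {b} = mk⇔ to from
    where
    to : 1 ≤ a × a ⊏ b × b ≤ K → Σ ℕ (λ j → (1 ≤ j) × (b ≡ H + j) × (b ≤ K) × (j ≤ a) × (a ≤ H))
    to (_ , (a≤H , H<b , b≤a+H) , b≤K) =
      b ∸ H , m<n⇒0<n∸m H<b , sym (m+[n∸m]≡n (<⇒≤ H<b)) , b≤K ,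
      m≤n+o⇒m∸n≤o b H (subst (b ≤_) (+-comm a H) b≤a+H) , a≤H
    from : Σ ℕ (λ j → (1 ≤ j) × (b ≡ H + j) × (b ≤ K) × (j ≤ a) × (a ≤ H)) → 1 ≤ a × a ⊏ b × b ≤ K
    from (j , 1≤j , refl , b≤K , j≤a , a≤H) =
      ≤-trans 1≤j j≤a , (a≤H , m<m+n H 1≤j , subst (H + j ≤_) (+-comm H a) (+-monoʳ-≤ H j≤a)) , b≤K

proposition2p15 : (n : ℕ) → 4 ≤ n →
    ((b : ℕ) → IsMinimal⁺ ((n ∸ 2) ∷ 2 ∷ []) b ⇔ ((1 ≤ b) × (b ≤ (n ∸ 1) / 2)))
    × ((b : ℕ) → IsMaximal⁺ ((n ∸ 2) ∷ 2 ∷ []) b ⇔ ((suc ((n ∸ 1) / 2) ≤ b) × (b ≤ n ∸ 2)))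
    × ((a b : ℕ) → Covers⁺ ((n ∸ 2) ∷ 2 ∷ []) b a
        ⇔ Σ ℕ (λ j → (1 ≤ j) × (b ≡ (n ∸ 1) / 2 + j) × (b ≤ n ∸ 2)
                     × (j ≤ a) × (a ≤ (n ∸ 1) / 2)))
proposition2p15 (suc (suc (suc (suc m)))) (s≤s (s≤s (s≤s (s≤s z≤n)))) =
  minimal⇔ , maximal⇔ , λ a b → ⊏⇔jump ⇔-∘ covers⇔⊏ a b
  where open Δ[K,2] m
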